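{- Let $\mathcal{B}$ be a box, $\alpha>0$, and let $\Gamma$ be an $\alpha$-fine $\mathcal{B}$-grid. Let $\mathcal{L}$ be an increasing sequence of $\mathcal{F}$-points contained in $\mathcal{B}$. Then there is a $D(\Gamma)$-chain $\vec{\mathcal{D}}=(\mathcal{D}_1,\dots,\mathcal{D}_r)$ such that the number of points of $\mathcal{L}$ not lying in $\bigcup_i\mathcal{D}_i$ is at most $\alpha\,\mathrm{w}(\mathcal{B})$.
   Context: $f:\{1,\dots,n\}\to\mathbb{N}^+$ is an array; $F(x)=\langle x,f(x)\rangle$ and $\mathcal{F}=\{F(x)\}$. Points are integer pairs; $P\prec Q$ means $x(P)<x(Q)$ and $y(P)\le y(Q)$. An increasing sequence is a set of points that can be ordered $P_0\prec P_1\prec\cdots\prec P_k$. A box $\mathcal{B}=X(\mathcal{B})\times Y(\mathcal{B})$ has integer index interval $X(\mathcal{B})=(x_L,x_R]=\{x_L+1,\dots,x_R\}$ and integer value interval $Y(\mathcal{B})=[y_B,y_T]$; $\mathrm{w}(\mathcal{B})=x_R-x_L$, $P_{BL}(\mathcal{B})=\langle x_L,y_B\rangle$, $P_{TR}(\mathcal{B})=\langle x_R,y_T\rangle$. For $Q\prec R$, $\mathrm{Box}(Q,R)$ is the box with $P_{BL}=Q$ and $P_{TR}=R$, i.e. $\{P: Q\prec P,\ x(P)\le x(R),\ y(P)\le y(R)\}$. A value interval $J$ is $\beta$-popular for $\mathcal{B}$ if at least $\beta\,\mathrm{w}(\mathcal{B})$ indices $x\in X(\mathcal{B})$ have $f(x)\in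 J$; a $\beta$-value net for $\mathcal{B}$ is $V\subseteq Y(\mathcal{B})$ containing $y_T$ and meeting every $\beta$-popular integer subinterval of $Y(\mathcal{B})$. A $\mathcal{B}$-grid is a set $\Gamma=X(\Gamma)\times Y(\Gamma)$ with $X(\Gamma)\subseteq X(\mathcal{B})\setminus\{x_R\}$ and $Y(\Gamma)$ a value net for $\mathcal{B}$ (subsets $\{x\}\times Y(\Gamma)$ are its columns). It is $\alpha$-fine if $X(\Gamma)$ contains an index from every subinterval of $X(\mathcal{B})$ of size exceeding $\alpha\,\mathrm{w}(\mathcal{B})$, and $Y(\Gamma)$ is an $\frac{\alpha}{|X(\Gamma)|}$-value net for $\mathcal{B}$. The grid digraph $D(\Gamma)$ has vertex set $\Gamma\cup\{P_{BL}(\mathcal{B}),P_{TR}(\mathcal{B})\}$ and arcs $(P_{BL}(\mathcal{B}),Q)$ for $Q$ in the leftmost column, $(Q,P_{TR}(\mathcal{B}))$ for $Q$ in the rightmost column, and $(P,Q)$ whenever $P\prec Q$ and $P,Q$ lie in adjacent columns of $\Gamma$. A $D(\Gamma)$-chain is the sequence of boxes $\mathrm{Box}(P_0,P_1),\dots,\mathrm{Box}(P_{r-1},P_r)$ associated with a directed path $P_0=P_{BL}(\mathcal{B}),P_1,\dots,P_r=P_{TR}(\mathcal{B})$ in $D(\Gamma)$.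
   Formalization: The parameter α ranges over the positive rationals. -}

module Defs where

open import Data.Nat as ℕ using (ℕ; suc)
open import Data.Fin using (Fin; toℕ)
open import Data.Integer as ℤ using (ℤ; +_; _-_)
import Data.Integer.Properties as ℤP
open import Data.Rational as ℚ using (ℚ)
open import Data.List using (List; []; _∷_; _++_; _∷ʳ_; length; filter; allFin)
open import Data.List.Relation.Unary.Any using (Any; any?)
open import Data.List.Membership.Propositional using (_∈_)
open import Data.List.Relation.Unary.Linked using (Linked)
open import Data.Product using (Σ; ∃; _×_; _,_; proj₁; proj₂)
open import Relation.Binary.PropositionalEquality using (_≡_)
open import Relation.Nullary using (Dec; ¬_; ¬?)
open import Relation.Nullary.Decidable using (_×-dec_)

Point : Set
Point = ℤ × ℤ

xc : Point → ℤ
xc = proj₁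

yc : Point → ℤ
yc = proj₂

_≺_ : Point → Point → Set
P ≺ Q = (xc P ℤ.< xc Q) × (yc P ℤ.≤ yc Q)

-- The array f : {1,…,n} → ℕ⁺ is given as  f : Fin n → ℕ  (index i ↦ i+1)
-- together with positivity of all values (see the statement).
index : {n : ℕ} → Fin n → ℤ
index i = + suc (toℕ i)

IsFPoint : (n : ℕ) → (Fin n → ℕ) → Point → Set
IsFPoint n f P = Σ (Fin n) λ i → (xc P ≡ index i) × (yc P ≡ + f i)

-- Boxes  B = (xL, xR] × [yB, yT]

record Box : Set where
  constructor box
  field
    xL xR yB yT : ℤ
open Box public

w : Box → ℤ
w B = xR B - xL B

PBL PTR : Box → Point
PBL B = (xL B , yB B)
PTR B = (xR B , yT B)

BoxOf : Point → Point → Box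
BoxOf Q R = box (xc Q) (xc R) (yc Q) (yc R)

_∈X_ : ℤ → Box → Set
x ∈X B = (xL B ℤ.< x) × (x ℤ.≤ xR B)

_∈X?_ : (x : ℤ) → (B : Box) → Dec (x ∈X B)
x ∈X? B = (xL B ℤP.<? x) ×-dec (x ℤP.≤? xR B)

_∈Y_ : ℤ → Box → Set
y ∈Y B = (yB B ℤ.≤ y) × (y ℤ.≤ yT B)

_∈B_ : Point → Box → Set
P ∈B B = (xc P ∈X B) × (yc P ∈Y B)

_∈B?_ : (P : Point) → (B : Box) → Dec (P ∈B B)
P ∈B? B = (xc P ∈X? B) ×-dec ((yB B ℤP.≤? yc P) ×-dec (yc P ℤP.≤? yT B))

ℤtoℚ : ℤ → ℚ
ℤtoℚ z = z ℚ./ 1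

ℕtoℚ : ℕ → ℚ
ℕtoℚ m = (+ m) ℚ./ 1

countIn : (n : ℕ) → (Fin n → ℕ) → Box → ℤ → ℤ → ℕ
countIn n f B a b =
  length (filter (λ i → (index i ∈X? B) ×-dec ((a ℤP.≤? + f i) ×-dec (+ f i ℤP.≤? b)))
                 (allFin n))

IsSubintervalY : Box → ℤ → ℤ → Set
IsSubintervalY B a b = (yB B ℤ.≤ a) × (a ℤ.≤ b) × (b ℤ.≤ yT B)

IsPopular : (n : ℕ) → (Fin n → ℕ) → ℚ → Box → ℤ → ℤ → Set
IsPopular n f β B a b = β ℚ.* ℤtoℚ (w B) ℚ.≤ ℕtoℚ (countIn n f B a b)

IsValueNet : (n : ℕ) → (Fin n → ℕ) → ℚ → Box → List ℤ → Set
IsValueNet n f β B V =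
  (∀ {y} → y ∈ V → y ∈Y B) ×
  (yT B ∈ V) ×
  (∀ a b → IsSubintervalY B a b → IsPopular n f β B a b →
     Σ ℤ λ y → (y ∈ V) × (a ℤ.≤ y) × (y ℤ.≤ b))

-- A B-grid Γ = X(Γ) × Y(Γ) is given by the list of its column
-- indices X(Γ), listed in strictly increasing order (so the columns are
-- ordered left to right and |X(Γ)| = length), and a list Y(Γ) of values.

record Grid : Set where
  constructor grid
  field
    Xs : List ℤ
    Ys : List ℤ
open Grid public

-- Γ is a B-grid: X(Γ) ⊆ X(B) ∖ {xR}, Y(Γ) a value net for B (the value net
-- condition with the specific β is imposed by IsFine below; here we
-- record Y(Γ) ⊆ Y(B) and y_T ∈ Y(Γ))
IsGrid : Box → Grid → Set
IsGrid B Γ =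
  Linked ℤ._<_ (Xs Γ) ×
  (∀ {x} → x ∈ Xs Γ → (xL B ℤ.< x) × (x ℤ.< xR B)) ×
  (∀ {y} → y ∈ Ys Γ → y ∈Y B) ×
  (yT B ∈ Ys Γ)

-- 1 / |X(Γ)|   (only used when X(Γ) is nonempty)
invLength : List ℤ → ℚ
invLength []       = ℚ.0ℚ
invLength (_ ∷ xs) = (+ 1) ℚ./ suc (length xs)

-- Γ is α-fine: X(Γ) is nonempty (needed for α/|X(Γ)| to make sense),
-- X(Γ) meets every subinterval (a, b] of X(B) of size b − a > α·w(B),
-- and Y(Γ) is an (α/|X(Γ)|)-value net for B.
IsFine : (n : ℕ) → (Fin n → ℕ) → ℚ → Box → Grid → Set
IsFine n f α B Γ =
  (Σ ℤ λ x → x ∈ Xs Γ) ×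
  (∀ a b → xL B ℤ.≤ a → a ℤ.≤ b → b ℤ.≤ xR B →
     α ℚ.* ℤtoℚ (w B) ℚ.< ℤtoℚ (b - a) →
     Σ ℤ λ x → (x ∈ Xs Γ) × (a ℤ.< x) × (x ℤ.≤ b)) ×
  IsValueNet n f (α ℚ.* invLength (Xs Γ)) B (Ys Γ)

data Adjacent : List ℤ → ℤ → ℤ → Set where
  here  : ∀ {c d xs} → Adjacent (c ∷ d ∷ xs) c d
  there : ∀ {x c d xs} → Adjacent xs c d → Adjacent (x ∷ xs) c d

Leftmost : List ℤ → ℤ → Set
Leftmost X c = Σ (List ℤ) λ xs → X ≡ c ∷ xs

Rightmost : List ℤ → ℤ → Set
Rightmost X c = Σ (List ℤ) λ xs → X ≡ xs ∷ʳ c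

_∈Γ_ : Point → Grid → Set
P ∈Γ Γ = (xc P ∈ Xs Γ) × (yc P ∈ Ys Γ)

data Arc (B : Box) (Γ : Grid) : Point → Point → Set where
  fromBL : ∀ {Q} → Q ∈Γ Γ → Leftmost (Xs Γ) (xc Q) → Arc B Γ (PBL B) Q
  toTR   : ∀ {Q} → Q ∈Γ Γ → Rightmost (Xs Γ) (xc Q) → Arc B Γ Q (PTR B)
  inner  : ∀ {P Q} → P ∈Γ Γ → Q ∈Γ Γ → Adjacent (Xs Γ) (xc P) (xc Q) →
           P ≺ Q → Arc B Γ P Q

pathVertices : Box → List Point → List Point
pathVertices B mids = (PBL B ∷ mids) ∷ʳ PTR B

IsPath : Box → Grid → List Point → Set
IsPath B Γ mids = Linked (Arc B Γ) (pathVertices B mids)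

consecutiveBoxes : List Point → List Box
consecutiveBoxes (P ∷ Q ∷ rest) = BoxOf P Q ∷ consecutiveBoxes (Q ∷ rest)
consecutiveBoxes _              = []

chainOf : Box → List Point → List Box
chainOf B mids = consecutiveBoxes (pathVertices B mids)

countOutside : List Box → List Point → ℕ
countOutside Ds L = length (filter (λ P → ¬? (any? (P ∈B?_) Ds)) L)

-- L is an increasing sequence of F-points contained in B (listed in
-- increasing ≺-order, so its points are distinct)
IsIncSeqIn : (n : ℕ) → (Fin n → ℕ) → Box → List Point → Set
IsIncSeqIn n f B L =
  Linked _≺_ L ×
  (∀ {P} → P ∈ L → IsFPoint n f P) ×
  (∀ {P} → P ∈ L → P ∈B B)

module Submission where

-- Let c₀ < c₁ < … < c_k be the columns of Γ.  For a column c let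
-- h(c) be the height of the staircase of L at c (the largest y(P) over P ∈ L
-- with x(P) ≤ c, or y_B), and let Y(c) be the least net value ≥ h(c) (or y_T).
-- The path through the vertices ⟨cⱼ, Y(cⱼ)⟩ is a path of D(Γ), since both h
-- and Y are monotone.  A point P ∈ L outside its chain lies, for the column
-- c = cⱼ just left of it, in the "gap" h(c) ≤ y(P) < Y(c).  The value interval
-- [h(c), Y(c) − 1] meets no net value, so it is not (α/|X(Γ)|)-popular; as the
-- points of L have distinct indices, fewer than (α/|X(Γ)|)·w(B) points of L
-- lie in each gap.  Summing over the |X(Γ)| columns bounds the uncovered
-- points by α·w(B).  Of α-fineness only the nonemptiness of X(Γ) and the
-- value-net condition are used.

open import Defs
open import Data.Nat using (ℕ) renaming (_≤_ to _≤ℕ_)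
open import Data.Fin using (Fin)
open import Data.Rational using (ℚ; 0ℚ; _<_; _≤_; _*_)
open import Data.List using (List)
open import Data.Product using (Σ; _×_)

import Data.Nat as ℕ
open import Data.Nat using (suc; z≤n; s≤s)
import Data.Nat.Properties as ℕP
open import Data.Integer as ℤ using (ℤ; +_)
import Data.Integer.Properties as ℤP
import Data.Rational as ℚ
import Data.Rational.Properties as ℚP
import Data.Rational.Unnormalised as ℚᵘ
import Data.Rational.Unnormalised.Properties as ℚᵘP
open import Algebra.Bundles using (CommutativeMonoid)
open import Algebra.Properties.CommutativeSemigroup
  (CommutativeMonoid.commutativeSemigroup ℚP.*-1-commutativeMonoid) using (x∙yz≈y∙xz)
open import Data.List using ([]; _∷_; _++_; _∷ʳ_; length; filter; allFin; map)
open import Data.Nat.ListAction using (sum)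
open import Data.List.Properties using (length-++-sucʳ; ++-assoc; filter-none; filter-accept; length-map)
open import Data.List.Relation.Unary.Any using (Any; here; there; any?)
open import Data.List.Relation.Unary.Any.Properties using (¬Any[])
import Data.List.Relation.Unary.All as All
open import Data.List.Relation.Unary.AllPairs as AllPairs using (AllPairs; _∷_)
import Data.List.Relation.Unary.AllPairs.Properties as AllPairsP
open import Data.List.Relation.Unary.Unique.Propositional using (Unique)
open import Data.List.Relation.Unary.Linked using (Linked; [-]; _∷_)
open import Data.List.Relation.Unary.Linked.Properties using (Linked⇒AllPairs)
open import Data.List.Membership.Propositional using (_∈_)
open import Data.List.Membership.Propositional.Properties
  using (∈-∃++; ∈-++⁻; ∈-++⁺ˡ; ∈-++⁺ʳ; ∈-filter⁺; ∈-filter⁻; ∈-allFin; ∈-map⁺; ∈-map⁻)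
open import Data.Product using (_,_; proj₁; proj₂)
open import Data.Sum using (_⊎_; inj₁; inj₂)
open import Data.Empty using (⊥-elim)
open import Function using (_∘_)
open import Relation.Binary.PropositionalEquality
open import Relation.Nullary using (Dec; yes; no; ¬_; ¬?)
open import Relation.Nullary.Decidable using (_×-dec_)
open import Relation.Unary using (Decidable)

distinct-⊆⇒length-≤ : ∀ {A : Set} {xs ys : List A} → Unique xs →
                      (∀ {x} → x ∈ xs → x ∈ ys) → length xs ≤ℕ length ys
distinct-⊆⇒length-≤ {xs = []} _ _ = z≤n
distinct-⊆⇒length-≤ {xs = x ∷ xs} (x∉xs ∷ distinct) xs⊆ys
  with ∈-∃++ (xs⊆ys (here refl))
... | ys₁ , ys₂ , refl rewrite length-++-sucʳ ys₁ x ys₂ =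
  s≤s (distinct-⊆⇒length-≤ distinct tail⊆)
  where
  -- the other elements differ from x, so they survive removing x from ys
  tail⊆ : ∀ {z} → z ∈ xs → z ∈ ys₁ ++ ys₂
  tail⊆ z∈xs with ∈-++⁻ ys₁ (xs⊆ys (there z∈xs))
  ... | inj₁ z∈ys₁           = ∈-++⁺ˡ z∈ys₁
  ... | inj₂ (here z≡x)      = ⊥-elim (All.lookup x∉xs z∈xs (sym z≡x))
  ... | inj₂ (there z∈ys₂)   = ∈-++⁺ʳ ys₁ z∈ys₂

length-filter-∷ : ∀ {A : Set} {P : A → Set} (P? : Decidable P) x xs →
                  length (filter P? xs) ≤ℕ length (filter P? (x ∷ xs))
length-filter-∷ P? x xs with P? x
... | yes _ = ℕP.n≤1+n _
... | no _  = ℕP.≤-refl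

filter-union-bound :
  ∀ {A : Set} {P Q R : A → Set} (P? : Decidable P) (Q? : Decidable Q) (R? : Decidable R) xs →
  (∀ {x} → x ∈ xs → P x → Q x ⊎ R x) →
  length (filter P? xs) ≤ℕ length (filter Q? xs) ℕ.+ length (filter R? xs)
filter-union-bound P? Q? R? [] _ = z≤n
filter-union-bound P? Q? R? (x ∷ xs) split with P? x
... | no _ = ℕP.≤-trans (filter-union-bound P? Q? R? xs (split ∘ there))
                       (ℕP.+-mono-≤ (length-filter-∷ Q? x xs) (length-filter-∷ R? x xs))
... | yes px with split (here refl) px
...   | inj₁ qx = begin
  suc (length (filter P? xs))                   ≤⟨ s≤s (filter-union-bound P? Q? R? xs (split ∘ there)) ⟩
  suc (length (filter Q? xs) ℕ.+ length (filter R? xs))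
                                                ≤⟨ s≤s (ℕP.+-monoʳ-≤ _ (length-filter-∷ R? x xs)) ⟩
  length (x ∷ filter Q? xs) ℕ.+ length (filter R? (x ∷ xs))
                                                ≡⟨ cong (λ ys → length ys ℕ.+ _) (sym (filter-accept Q? qx)) ⟩
  length (filter Q? (x ∷ xs)) ℕ.+ length (filter R? (x ∷ xs)) ∎
  where open ℕP.≤-Reasoning
...   | inj₂ rx = begin
  suc (length (filter P? xs))                   ≤⟨ s≤s (filter-union-bound P? Q? R? xs (split ∘ there)) ⟩
  suc (length (filter Q? xs) ℕ.+ length (filter R? xs))
                                                ≡⟨ sym (ℕP.+-suc _ _) ⟩
  length (filter Q? xs) ℕ.+ length (x ∷ filter R? xs)
                                                ≤⟨ ℕP.+-monoˡ-≤ _ (length-filter-∷ Q? x xs) ⟩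
  length (filter Q? (x ∷ xs)) ℕ.+ length (x ∷ filter R? xs)
                                                ≡⟨ cong (λ ys → _ ℕ.+ length ys) (sym (filter-accept R? rx)) ⟩
  length (filter Q? (x ∷ xs)) ℕ.+ length (filter R? (x ∷ xs)) ∎
  where open ℕP.≤-Reasoning

filter-cover-bound :
  ∀ {A C : Set} {P : A → Set} {G : C → A → Set}
  (P? : Decidable P) (G? : ∀ c → Decidable (G c)) (cs : List C) xs →
  (∀ {x} → x ∈ xs → P x → Any (λ c → G c x) cs) →
  length (filter P? xs) ≤ℕ sum (map (λ c → length (filter (G? c) xs)) cs)
filter-cover-bound P? G? [] xs cover =
  ℕP.≤-reflexive (cong length (filter-none P? (All.tabulate (λ x∈xs → ¬Any[] ∘ cover x∈xs))))
filter-cover-bound {P = P} {G} P? G? (c ∷ cs) xs cover =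
  ℕP.≤-trans (filter-union-bound P? (G? c) P∖Gc? xs split)
             (ℕP.+-monoʳ-≤ _ (filter-cover-bound P∖Gc? G? cs xs cover-rest))
  where
  P∖Gc? : Decidable (λ x → P x × ¬ G c x)
  P∖Gc? x = P? x ×-dec ¬? (G? c x)

  split : ∀ {x} → x ∈ xs → P x → G c x ⊎ (P x × ¬ G c x)
  split {x} _ px with G? c x
  ... | yes g = inj₁ g
  ... | no ¬g = inj₂ (px , ¬g)

  cover-rest : ∀ {x} → x ∈ xs → P x × ¬ G c x → Any (λ c′ → G c′ x) cs
  cover-rest x∈xs (px , ¬g) with cover x∈xs px
  ... | here g      = ⊥-elim (¬g g)
  ... | there anyCs = anyCs

toℚᵘ-ℕtoℚ : ∀ m → ℚ.toℚᵘ (ℕtoℚ m) ℚᵘ.≃ ℚᵘ.mkℚᵘ (+ m) 0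
toℚᵘ-ℕtoℚ m = ℚP.toℚᵘ-fromℚᵘ (ℚᵘ.mkℚᵘ (+ m) 0)

ℕtoℚ-+ : ∀ a b → ℕtoℚ (a ℕ.+ b) ≡ ℕtoℚ a ℚ.+ ℕtoℚ b
ℕtoℚ-+ a b = ℚP.toℚᵘ-injective
  (ℚᵘP.≃-trans (toℚᵘ-ℕtoℚ (a ℕ.+ b))
  (ℚᵘP.≃-trans (ℚᵘ.*≡* cross-multiplied)
  (ℚᵘP.≃-sym (ℚᵘP.≃-trans (ℚP.toℚᵘ-homo-+ (ℕtoℚ a) (ℕtoℚ b))
                          (ℚᵘP.+-cong (toℚᵘ-ℕtoℚ a) (toℚᵘ-ℕtoℚ b))))))
  where
  cross-multiplied : + (a ℕ.+ b) ℤ.* + 1 ≡ (+ a ℤ.* + 1 ℤ.+ + b ℤ.* + 1) ℤ.* + 1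
  cross-multiplied = begin
    + (a ℕ.+ b) ℤ.* + 1                       ≡⟨ ℤP.*-identityʳ (+ (a ℕ.+ b)) ⟩
    + (a ℕ.+ b)                               ≡⟨ ℤP.pos-+ a b ⟩
    + a ℤ.+ + b                               ≡⟨ cong₂ ℤ._+_ (sym (ℤP.*-identityʳ (+ a))) (sym (ℤP.*-identityʳ (+ b))) ⟩
    + a ℤ.* + 1 ℤ.+ + b ℤ.* + 1               ≡⟨ sym (ℤP.*-identityʳ (+ a ℤ.* + 1 ℤ.+ + b ℤ.* + 1)) ⟩
    (+ a ℤ.* + 1 ℤ.+ + b ℤ.* + 1) ℤ.* + 1 ∎
    where open ≡-Reasoning

ℕtoℚ-nonNeg : ∀ m → 0ℚ ≤ ℕtoℚ m
ℕtoℚ-nonNeg m = ℚP.nonNegative⁻¹ (ℕtoℚ m) {{ℚP.normalize-nonNeg m 1}}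

ℕtoℚ-mono : ∀ {a b} → a ≤ℕ b → ℕtoℚ a ≤ ℕtoℚ b
ℕtoℚ-mono {a} {b} a≤b = begin
  ℕtoℚ a                       ≡⟨ sym (ℚP.+-identityʳ (ℕtoℚ a)) ⟩
  ℕtoℚ a ℚ.+ 0ℚ                ≤⟨ ℚP.+-monoʳ-≤ (ℕtoℚ a) (ℕtoℚ-nonNeg (b ℕ.∸ a)) ⟩
  ℕtoℚ a ℚ.+ ℕtoℚ (b ℕ.∸ a)    ≡⟨ sym (ℕtoℚ-+ a (b ℕ.∸ a)) ⟩
  ℕtoℚ (a ℕ.+ (b ℕ.∸ a))       ≡⟨ cong ℕtoℚ (ℕP.m+[n∸m]≡n a≤b) ⟩
  ℕtoℚ b ∎
  where open ℚP.≤-Reasoning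

ℕtoℚ-sum-bound : ∀ {C : Set} (cs : List C) (g : C → ℕ) γ →
                 (∀ {c} → c ∈ cs → ℕtoℚ (g c) ≤ γ) →
                 ℕtoℚ (sum (map g cs)) ≤ ℕtoℚ (length cs) * γ
ℕtoℚ-sum-bound [] g γ _ = ℚP.≤-reflexive (sym (ℚP.*-zeroˡ γ))
ℕtoℚ-sum-bound (c ∷ cs) g γ bounded = begin
  ℕtoℚ (g c ℕ.+ sum (map g cs))             ≡⟨ ℕtoℚ-+ (g c) _ ⟩
  ℕtoℚ (g c) ℚ.+ ℕtoℚ (sum (map g cs))      ≤⟨ ℚP.+-mono-≤ (bounded (here refl))
                                                 (ℕtoℚ-sum-bound cs g γ (bounded ∘ there)) ⟩
  γ ℚ.+ ℕtoℚ (length cs) * γ                ≡⟨ cong (ℚ._+ ℕtoℚ (length cs) * γ) (sym (ℚP.*-identityˡ γ)) ⟩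
  ℚ.1ℚ * γ ℚ.+ ℕtoℚ (length cs) * γ         ≡⟨ sym (ℚP.*-distribʳ-+ γ ℚ.1ℚ (ℕtoℚ (length cs))) ⟩
  (ℚ.1ℚ ℚ.+ ℕtoℚ (length cs)) * γ           ≡⟨ cong (_* γ) (sym (ℕtoℚ-+ 1 (length cs))) ⟩
  ℕtoℚ (length (c ∷ cs)) * γ ∎
  where open ℚP.≤-Reasoning

ℕtoℚ-*-reciprocal : ∀ l → ℕtoℚ (suc l) * ((+ 1) ℚ./ suc l) ≡ ℚ.1ℚ
ℕtoℚ-*-reciprocal l = ℚP.toℚᵘ-injective
  (ℚᵘP.≃-trans (ℚP.toℚᵘ-homo-* (ℕtoℚ (suc l)) ((+ 1) ℚ./ suc l))
  (ℚᵘP.≃-trans (ℚᵘP.*-cong (toℚᵘ-ℕtoℚ (suc l)) (ℚP.toℚᵘ-fromℚᵘ (ℚᵘ.mkℚᵘ (+ 1) l)))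
               (ℚᵘ.*≡* cross-multiplied)))
  where
  cross-multiplied : (+ suc l ℤ.* + 1) ℤ.* + 1 ≡ + 1 ℤ.* + (1 ℕ.* suc l)
  cross-multiplied = begin
    (+ suc l ℤ.* + 1) ℤ.* + 1    ≡⟨ ℤP.*-identityʳ _ ⟩
    + suc l ℤ.* + 1              ≡⟨ ℤP.*-identityʳ _ ⟩
    + suc l                      ≡⟨ cong +_ (sym (ℕP.*-identityˡ (suc l))) ⟩
    + (1 ℕ.* suc l)              ≡⟨ sym (ℤP.*-identityˡ _) ⟩
    + 1 ℤ.* + (1 ℕ.* suc l) ∎
    where open ≡-Reasoning

equal-shares-sum : ∀ l α w → ℕtoℚ (suc l) * ((α * ((+ 1) ℚ./ suc l)) * w) ≡ α * w
equal-shares-sum l α w = begin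
  m * ((α * q) * w)    ≡⟨ cong (m *_) (ℚP.*-assoc α q w) ⟩
  m * (α * (q * w))    ≡⟨ x∙yz≈y∙xz m α (q * w) ⟩
  α * (m * (q * w))    ≡⟨ cong (α *_) (sym (ℚP.*-assoc m q w)) ⟩
  α * ((m * q) * w)    ≡⟨ cong (λ r → α * (r * w)) (ℕtoℚ-*-reciprocal l) ⟩
  α * (ℚ.1ℚ * w)       ≡⟨ cong (α *_) (ℚP.*-identityˡ w) ⟩
  α * w ∎
  where
  open ≡-Reasoning
  m q : ℚ
  m = ℕtoℚ (suc l)
  q = (+ 1) ℚ./ suc l

share-nonNeg : ∀ l α (B : Box) → 0ℚ < α → xL B ℤ.≤ xR B →
               0ℚ ≤ (α * ((+ 1) ℚ./ suc l)) * ℤtoℚ (w B)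
share-nonNeg l α B α>0 xL≤xR = ℚP.nonNegative⁻¹ _
  {{ℚP.nonNeg*nonNeg⇒nonNeg (α * q)
      {{ℚP.nonNeg*nonNeg⇒nonNeg α {{ℚP.pos⇒nonNeg α {{ℚ.positive α>0}}}}
                                q {{ℚP.normalize-nonNeg 1 (suc l)}}}}
      (ℤtoℚ (w B)) {{width-nonNeg (w B) (ℤP.i≤j⇒0≤j-i xL≤xR)}}}}
  where
  q : ℚ
  q = (+ 1) ℚ./ suc l

  width-nonNeg : ∀ z → ℤ.0ℤ ℤ.≤ z → ℚ.NonNegative (ℤtoℚ z)
  width-nonNeg (+ k) _ = ℚP.normalize-nonNeg k 1

avoids-net⇒unpopular :
  ∀ {n f β B V a b} → IsValueNet n f β B V → IsSubintervalY B a b →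
  (∀ {y} → y ∈ V → a ℤ.≤ y → b ℤ.< y) →
  ℕtoℚ (countIn n f B a b) < β * ℤtoℚ (w B)
avoids-net⇒unpopular {n} {f} {β} {B} {a = a} {b} (_ , _ , meets) sub avoids = ℚP.≰⇒> popular⇒⊥
  where
  popular⇒⊥ : ¬ IsPopular n f β B a b
  popular⇒⊥ popular with meets a b sub popular
  ... | y , y∈V , a≤y , y≤b = ℤP.<-irrefl refl (ℤP.≤-<-trans y≤b (avoids y∈V a≤y))

≺-trans : ∀ {P Q R} → P ≺ Q → Q ≺ R → P ≺ R
≺-trans (x<x′ , y≤y′) (x′<x″ , y′≤y″) = ℤP.<-trans x<x′ x′<x″ , ℤP.≤-trans y≤y′ y′≤y″

increasing⇒y-mono : ∀ {Ps} → AllPairs _≺_ Ps → ∀ {P Q} → P ∈ Ps → Q ∈ Ps →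
                    xc Q ℤ.< xc P → yc Q ℤ.≤ yc P
increasing⇒y-mono (_ ∷ _)   (here refl) (here refl) x<x   = ⊥-elim (ℤP.<-irrefl refl x<x)
increasing⇒y-mono (P≺ ∷ _)  (here refl) (there Q∈) xQ<xP = ⊥-elim (ℤP.<-asym xQ<xP (proj₁ (All.lookup P≺ Q∈)))
increasing⇒y-mono (Q≺ ∷ _)  (there P∈) (here refl) _     = proj₂ (All.lookup Q≺ P∈)
increasing⇒y-mono (_ ∷ inc) (there P∈) (there Q∈) xQ<xP = increasing⇒y-mono inc P∈ Q∈ xQ<xP

staircase : ℤ → List Point → ℤ → ℤ
staircase y₀ []       c = y₀
staircase y₀ (P ∷ Ps) c with xc P ℤP.≤? c
... | yes _ = yc P ℤ.⊔ staircase y₀ Ps c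
... | no _  = staircase y₀ Ps c

staircase-floor : ∀ y₀ Ps c → y₀ ℤ.≤ staircase y₀ Ps c
staircase-floor y₀ []       c = ℤP.≤-refl
staircase-floor y₀ (P ∷ Ps) c with xc P ℤP.≤? c
... | yes _ = ℤP.≤-trans (staircase-floor y₀ Ps c) (ℤP.i≤j⊔i (yc P) _)
... | no _  = staircase-floor y₀ Ps c

staircase-upper : ∀ y₀ Ps c {P} → P ∈ Ps → xc P ℤ.≤ c → yc P ℤ.≤ staircase y₀ Ps c
staircase-upper y₀ (P ∷ Ps) c (here refl) xP≤c with xc P ℤP.≤? c
... | yes _   = ℤP.i≤i⊔j (yc P) _
... | no xP≰c = ⊥-elim (xP≰c xP≤c)
staircase-upper y₀ (Q ∷ Ps) c (there P∈) xP≤c with xc Q ℤP.≤? c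
... | yes _ = ℤP.≤-trans (staircase-upper y₀ Ps c P∈ xP≤c) (ℤP.i≤j⊔i (yc Q) _)
... | no _  = staircase-upper y₀ Ps c P∈ xP≤c

staircase-least : ∀ y₀ Ps c u → y₀ ℤ.≤ u →
                  (∀ {P} → P ∈ Ps → xc P ℤ.≤ c → yc P ℤ.≤ u) → staircase y₀ Ps c ℤ.≤ u
staircase-least y₀ []       c u y₀≤u _ = y₀≤u
staircase-least y₀ (P ∷ Ps) c u y₀≤u bounded with xc P ℤP.≤? c
... | yes xP≤c = ℤP.⊔-lub (bounded (here refl) xP≤c) (staircase-least y₀ Ps c u y₀≤u (bounded ∘ there))
... | no _     = staircase-least y₀ Ps c u y₀≤u (bounded ∘ there)

roundUp : ℤ → List ℤ → ℤ → ℤ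
roundUp top []       h = top
roundUp top (y ∷ ys) h with h ℤP.≤? y
... | yes _ = y ℤ.⊓ roundUp top ys h
... | no _  = roundUp top ys h

roundUp-∈ : ∀ top ys h → roundUp top ys h ≡ top ⊎ roundUp top ys h ∈ ys
roundUp-∈ top []       h = inj₁ refl
roundUp-∈ top (y ∷ ys) h with h ℤP.≤? y
... | no _ with roundUp-∈ top ys h
...   | inj₁ ≡top = inj₁ ≡top
...   | inj₂ ∈ys  = inj₂ (there ∈ys)
roundUp-∈ top (y ∷ ys) h | yes _ with ℤP.⊓-sel y (roundUp top ys h)
...   | inj₁ ≡y = inj₂ (subst (_∈ y ∷ ys) (sym ≡y) (here refl))
...   | inj₂ ≡rest with roundUp-∈ top ys h
...     | inj₁ ≡top = inj₁ (trans ≡rest ≡top)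
...     | inj₂ ∈ys  = inj₂ (subst (_∈ y ∷ ys) (sym ≡rest) (there ∈ys))

roundUp-≥ : ∀ top ys h → h ℤ.≤ top → h ℤ.≤ roundUp top ys h
roundUp-≥ top []       h h≤top = h≤top
roundUp-≥ top (y ∷ ys) h h≤top with h ℤP.≤? y
... | yes h≤y = ℤP.⊓-glb h≤y (roundUp-≥ top ys h h≤top)
... | no _    = roundUp-≥ top ys h h≤top

roundUp-least : ∀ top ys h {y} → y ∈ ys → h ℤ.≤ y → roundUp top ys h ℤ.≤ y
roundUp-least top (y ∷ ys) h (here refl) h≤y with h ℤP.≤? y
... | yes _  = ℤP.i⊓j≤i y _
... | no h≰y = ⊥-elim (h≰y h≤y)
roundUp-least top (y′ ∷ ys) h (there y∈) h≤y with h ℤP.≤? y′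
... | yes _ = ℤP.≤-trans (ℤP.i⊓j≤j y′ _) (roundUp-least top ys h y∈ h≤y)
... | no _  = roundUp-least top ys h y∈ h≤y

adjacent-++ : ∀ pre {c d : ℤ} {xs} → Adjacent (pre ++ c ∷ d ∷ xs) c d
adjacent-++ []        = here
adjacent-++ (_ ∷ pre) = there (adjacent-++ pre)

module Staircase (n : ℕ) (f : Fin n → ℕ) (B : Box) (Ys : List ℤ)
                 (Ys⊆Y : ∀ {y} → y ∈ Ys → y ∈Y B) (yT∈Ys : yT B ∈ Ys)
                 (L : List Point) (incL : IsIncSeqIn n f B L) where

  L-increasing : AllPairs _≺_ L
  L-increasing = Linked⇒AllPairs ≺-trans (proj₁ incL)

  L⊆B : ∀ {P} → P ∈ L → P ∈B B
  L⊆B = proj₂ (proj₂ incL)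

  h : ℤ → ℤ
  h = staircase (yB B) L

  h-≤-yT : ∀ c → h c ℤ.≤ yT B
  h-≤-yT c = staircase-least (yB B) L c (yT B) (ℤP.≤-trans (proj₁ (Ys⊆Y yT∈Ys)) (proj₂ (Ys⊆Y yT∈Ys)))
                             (λ P∈L _ → proj₂ (proj₂ (L⊆B P∈L)))

  h-above : ∀ c {P} → P ∈ L → xc P ℤ.≤ c → yc P ℤ.≤ h c
  h-above = staircase-upper (yB B) L

  -- since L is increasing, a point right of c is on or above the staircase at c
  h-below : ∀ c {P} → P ∈ L → c ℤ.< xc P → h c ℤ.≤ yc P
  h-below c P∈L c<xP = staircase-least (yB B) L c _ (proj₁ (proj₂ (L⊆B P∈L)))
    (λ Q∈L xQ≤c → increasing⇒y-mono L-increasing P∈L Q∈L (ℤP.≤-<-trans xQ≤c c<xP))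

  h-mono : ∀ {c c′} → c ℤ.≤ c′ → h c ℤ.≤ h c′
  h-mono {c} {c′} c≤c′ = staircase-least (yB B) L c (h c′) (staircase-floor (yB B) L c′)
    (λ P∈L xP≤c → h-above c′ P∈L (ℤP.≤-trans xP≤c c≤c′))

  Y : ℤ → ℤ
  Y c = roundUp (yT B) Ys (h c)

  Y-∈ : ∀ c → Y c ∈ Ys
  Y-∈ c with roundUp-∈ (yT B) Ys (h c)
  ... | inj₁ ≡yT = subst (_∈ Ys) (sym ≡yT) yT∈Ys
  ... | inj₂ ∈Ys = ∈Ys

  h≤Y : ∀ c → h c ℤ.≤ Y c
  h≤Y c = roundUp-≥ (yT B) Ys (h c) (h-≤-yT c)

  Y-least : ∀ c {y} → y ∈ Ys → h c ℤ.≤ y → Y c ℤ.≤ y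
  Y-least c = roundUp-least (yT B) Ys (h c)

  Y-mono : ∀ {c c′} → c ℤ.≤ c′ → Y c ℤ.≤ Y c′
  Y-mono {c} {c′} c≤c′ = Y-least c (Y-∈ c′) (ℤP.≤-trans (h-mono c≤c′) (h≤Y c′))

  vertex : ℤ → Point
  vertex c = (c , Y c)

  -- The vertices of consecutive columns, ending at P_TR(B), form a path of
  -- D(Γ); X ≡ pre ++ c ∷ cs locates column c inside the full column list.
  path-from : ∀ (X pre : List ℤ) c cs → X ≡ pre ++ c ∷ cs → Linked ℤ._<_ (c ∷ cs) →
              Linked (Arc B (grid X Ys)) (vertex c ∷ (map vertex cs ∷ʳ PTR B))
  path-from X pre c [] X≡ _ =
    toTR (subst (c ∈_) (sym X≡) (∈-++⁺ʳ pre (here refl)) , Y-∈ c) (pre , X≡) ∷ [-]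
  path-from X pre c (d ∷ ds) X≡ (c<d ∷ increasing) =
    inner (subst (c ∈_) (sym X≡) (∈-++⁺ʳ pre (here refl)) , Y-∈ c)
          (subst (d ∈_) (sym X≡) (∈-++⁺ʳ pre (there (here refl))) , Y-∈ d)
          (subst (λ X′ → Adjacent X′ c d) (sym X≡) (adjacent-++ pre))
          (c<d , Y-mono (ℤP.<⇒≤ c<d))
    ∷ path-from X (pre ∷ʳ c) d ds (trans X≡ (sym (++-assoc pre (c ∷ []) (d ∷ ds)))) increasing

  staircase-path : ∀ c cs → Linked ℤ._<_ (c ∷ cs) → IsPath B (grid (c ∷ cs) Ys) (map vertex (c ∷ cs))
  staircase-path c cs increasing =
    fromBL (here refl , Y-∈ c) (cs , refl) ∷ path-from (c ∷ cs) [] c cs refl increasing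

  InGap : ℤ → Point → Set
  InGap c P = (h c ℤ.≤ yc P) × (yc P ℤ.< Y c)

  inGap? : ∀ c → Decidable (InGap c)
  inGap? c P = (h c ℤP.≤? yc P) ×-dec (yc P ℤP.<? Y c)

  above-or-in-gap : ∀ c {P} → P ∈ L → c ℤ.< xc P → Y c ℤ.≤ yc P ⊎ InGap c P
  above-or-in-gap c {P} P∈L c<xP with Y c ℤP.≤? yc P
  ... | yes Y≤y = inj₁ Y≤y
  ... | no Y≰y  = inj₂ (h-below c P∈L c<xP , ℤP.≰⇒> Y≰y)

  covered-or-in-gap-from : ∀ c cs {P} → P ∈ L → c ℤ.< xc P →
    Any (P ∈B_) (consecutiveBoxes (vertex c ∷ (map vertex cs ∷ʳ PTR B))) ⊎
    Any (λ c′ → InGap c′ P) (c ∷ cs)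
  covered-or-in-gap-from c cs {P} P∈L c<xP with above-or-in-gap c P∈L c<xP
  ... | inj₂ gap = inj₂ (here gap)
  covered-or-in-gap-from c [] {P} P∈L c<xP | inj₁ Y≤y =
    inj₁ (here ((c<xP , proj₂ (proj₁ (L⊆B P∈L))) , (Y≤y , proj₂ (proj₂ (L⊆B P∈L)))))
  covered-or-in-gap-from c (d ∷ ds) {P} P∈L c<xP | inj₁ Y≤y with xc P ℤP.≤? d
  ... | yes xP≤d = inj₁ (here ((c<xP , xP≤d) , (Y≤y , ℤP.≤-trans (h-above d P∈L xP≤d) (h≤Y d))))
  ... | no xP≰d with covered-or-in-gap-from d ds P∈L (ℤP.≰⇒> xP≰d)
  ...   | inj₁ covered = inj₁ (there covered)
  ...   | inj₂ inGap   = inj₂ (there inGap)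

  covered-or-in-gap : ∀ c cs {P} → P ∈ L →
    Any (P ∈B_) (chainOf B (map vertex (c ∷ cs))) ⊎ Any (λ c′ → InGap c′ P) (c ∷ cs)
  covered-or-in-gap c cs {P} P∈L with xc P ℤP.≤? c
  ... | yes xP≤c = inj₁ (here ((proj₁ (proj₁ (L⊆B P∈L)) , xP≤c) ,
                              (proj₁ (proj₂ (L⊆B P∈L)) , ℤP.≤-trans (h-above c P∈L xP≤c) (h≤Y c))))
  ... | no xP≰c with covered-or-in-gap-from c cs P∈L (ℤP.≰⇒> xP≰c)
  ...   | inj₁ covered = inj₁ (there covered)
  ...   | inj₂ inGap   = inj₂ inGap

  gapCount : ℤ → ℕ
  gapCount c = length (filter (inGap? c) L)

  outside≤gaps : ∀ c cs →
    countOutside (chainOf B (map vertex (c ∷ cs))) L ≤ℕ sum (map gapCount (c ∷ cs))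
  outside≤gaps c cs =
    filter-cover-bound (λ P → ¬? (any? (P ∈B?_) (chainOf B (map vertex (c ∷ cs))))) inGap? (c ∷ cs) L
      uncovered⇒in-gap
    where
    uncovered⇒in-gap : ∀ {P} → P ∈ L → ¬ Any (P ∈B_) (chainOf B (map vertex (c ∷ cs))) →
                       Any (λ c′ → InGap c′ P) (c ∷ cs)
    uncovered⇒in-gap P∈L uncovered with covered-or-in-gap c cs P∈L
    ... | inj₁ covered = ⊥-elim (uncovered covered)
    ... | inj₂ inGap   = inGap

  -- The points of L in the gap of c have distinct indices x ∈ X(B) with
  -- f(x) ∈ [h c, Y c − 1], so there are at most countIn of them.
  gapCount≤countIn : ∀ c → gapCount c ≤ℕ countIn n f B (h c) (ℤ.pred (Y c))
  gapCount≤countIn c = begin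
    gapCount c                   ≡⟨ sym (length-map xc gapPoints) ⟩
    length (map xc gapPoints)    ≤⟨ distinct-⊆⇒length-≤ distinct xs⊆indices ⟩
    length (map index indices)   ≡⟨ length-map index indices ⟩
    length indices ∎
    where
    open ℕP.≤-Reasoning
    gapPoints : List Point
    gapPoints = filter (inGap? c) L

    inInterval? : Decidable (λ i → (index i ∈X B) × (h c ℤ.≤ + f i) × (+ f i ℤ.≤ ℤ.pred (Y c)))
    inInterval? i = (index i ∈X? B) ×-dec ((h c ℤP.≤? + f i) ×-dec (+ f i ℤP.≤? ℤ.pred (Y c)))

    indices : List (Fin n)
    indices = filter inInterval? (allFin n)

    distinct : Unique (map xc gapPoints)
    distinct = AllPairsP.map⁺ (AllPairs.map (λ P≺Q → ℤP.<⇒≢ (proj₁ P≺Q))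
                                            (AllPairsP.filter⁺ (inGap? c) L-increasing))

    xs⊆indices : ∀ {x} → x ∈ map xc gapPoints → x ∈ map index indices
    xs⊆indices x∈ with ∈-map⁻ xc x∈
    ... | P , P∈gap , refl with ∈-filter⁻ (inGap? c) P∈gap
    ...   | P∈L , (h≤y , y<Y) with proj₁ (proj₂ incL) P∈L
    ...     | i , xP≡ , yP≡ = subst (_∈ map index indices) (sym xP≡)
              (∈-map⁺ index (∈-filter⁺ inInterval? (∈-allFin i)
                 ( subst (_∈X B) xP≡ (proj₁ (L⊆B P∈L))
                 , subst (h c ℤ.≤_) yP≡ h≤y
                 , subst (ℤ._≤ ℤ.pred (Y c)) yP≡ (ℤP.i<j⇒i≤pred[j] y<Y))))

  empty-gap : ∀ c → ¬ (h c ℤ.≤ ℤ.pred (Y c)) → gapCount c ≡ 0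
  empty-gap c h≰Y-1 = cong length (filter-none (inGap? c) (All.tabulate not-in-gap))
    where
    not-in-gap : ∀ {P} → P ∈ L → ¬ InGap c P
    not-in-gap _ (h≤y , y<Y) = h≰Y-1 (ℤP.≤-trans h≤y (ℤP.i<j⇒i≤pred[j] y<Y))

  -- A nonempty gap interval [h c, Y c − 1] avoids the β-value net Ys, so it
  -- is unpopular and holds fewer than β·w(B) points of L.
  nonempty-gap-bound : ∀ β → IsValueNet n f β B Ys → ∀ c → h c ℤ.≤ ℤ.pred (Y c) →
                       ℕtoℚ (gapCount c) < β * ℤtoℚ (w B)
  nonempty-gap-bound β net c h≤Y-1 = ℚP.≤-<-trans gap≤countIn countIn<share
    where
    Y-1<Y : ℤ.pred (Y c) ℤ.< Y c
    Y-1<Y = ℤP.i≤pred[j]⇒i<j ℤP.≤-refl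

    subinterval : IsSubintervalY B (h c) (ℤ.pred (Y c))
    subinterval = staircase-floor (yB B) L c , h≤Y-1 ,
                  ℤP.≤-trans (ℤP.<⇒≤ Y-1<Y) (proj₂ (Ys⊆Y (Y-∈ c)))

    avoids : ∀ {y} → y ∈ Ys → h c ℤ.≤ y → ℤ.pred (Y c) ℤ.< y
    avoids y∈Ys h≤y = ℤP.<-≤-trans Y-1<Y (Y-least c y∈Ys h≤y)

    gap≤countIn : ℕtoℚ (gapCount c) ≤ ℕtoℚ (countIn n f B (h c) (ℤ.pred (Y c)))
    gap≤countIn = ℕtoℚ-mono {gapCount c} {countIn n f B (h c) (ℤ.pred (Y c))} (gapCount≤countIn c)

    countIn<share : ℕtoℚ (countIn n f B (h c) (ℤ.pred (Y c))) < β * ℤtoℚ (w B)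
    countIn<share = avoids-net⇒unpopular {n} {f} {β} {B} {Ys} net subinterval avoids

  gap-count-bound : ∀ β → IsValueNet n f β B Ys → 0ℚ ≤ β * ℤtoℚ (w B) →
                    ∀ c → ℕtoℚ (gapCount c) ≤ β * ℤtoℚ (w B)
  gap-count-bound β net share≥0 c = by-cases (h c ℤP.≤? ℤ.pred (Y c))
    where
    by-cases : Dec (h c ℤ.≤ ℤ.pred (Y c)) → ℕtoℚ (gapCount c) ≤ β * ℤtoℚ (w B)
    by-cases (yes h≤Y-1) = ℚP.<⇒≤ (nonempty-gap-bound β net c h≤Y-1)
    by-cases (no h≰Y-1)  = subst (λ k → ℕtoℚ k ≤ β * ℤtoℚ (w B)) (sym (empty-gap c h≰Y-1)) share≥0

lemma5p14 : (n : ℕ) (f : Fin n → ℕ) → (∀ i → 1 ≤ℕ f i) →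
    (B : Box) (α : ℚ) → 0ℚ < α →
    (Γ : Grid) → IsGrid B Γ → IsFine n f α B Γ →
    (L : List Point) → IsIncSeqIn n f B L →
    Σ (List Point) λ mids → IsPath B Γ mids ×
      (ℕtoℚ (countOutside (chainOf B mids) L) ≤ α * ℤtoℚ (w B))
-- α-fineness makes X(Γ) nonempty; the staircase path through the columns
-- leaves at most |X(Γ)| · (α/|X(Γ)|)·w(B) points of L uncovered.
lemma5p14 n f _ B α _ (grid [] Ys) _ ((_ , ()) , _) L _
lemma5p14 n f _ B α α>0 (grid (c ∷ cs) Ys) (columns-increasing , columns⊆X , Ys⊆Y , yT∈Ys)
          (_ , _ , net) L incL =
  map vertex (c ∷ cs) , staircase-path c cs columns-increasing , outside-bound
  where
  open Staircase n f B Ys Ys⊆Y yT∈Ys L incL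

  β : ℚ
  β = α * ((+ 1) ℚ./ suc (length cs))

  share≥0 : 0ℚ ≤ β * ℤtoℚ (w B)
  share≥0 = share-nonNeg (length cs) α B α>0
              (ℤP.<⇒≤ (ℤP.<-trans (proj₁ (columns⊆X (here refl))) (proj₂ (columns⊆X (here refl)))))

  outside-bound : ℕtoℚ (countOutside (chainOf B (map vertex (c ∷ cs))) L) ≤ α * ℤtoℚ (w B)
  outside-bound = begin
    ℕtoℚ (countOutside (chainOf B (map vertex (c ∷ cs))) L)
      ≤⟨ ℕtoℚ-mono (outside≤gaps c cs) ⟩
    ℕtoℚ (sum (map gapCount (c ∷ cs)))
      ≤⟨ ℕtoℚ-sum-bound (c ∷ cs) gapCount (β * ℤtoℚ (w B)) (λ {c′} _ → gap-count-bound β net share≥0 c′) ⟩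
    ℕtoℚ (length (c ∷ cs)) * (β * ℤtoℚ (w B))
      ≡⟨ equal-shares-sum (length cs) α (ℤtoℚ (w B)) ⟩
    α * ℤtoℚ (w B) ∎
    where open ℚP.≤-Reasoning
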